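{- Let $s_B=[s_B[n,k]]_{n,k\ge0}$ and $S_B=[S_B[n,k]]_{n,k\ge 0}$ be infinite matrices (rows indexed by $n\in\mathbb{N}$, columns by $k\in\mathbb{N}$). Then $s_B S_B=I$, the identity matrix.
   Context: $q$ is an indeterminate and $[m]=(1-q^m)/(1-q)$. Define $S_B[n,k]$ for $n\in\mathbb{N}$, $k\in\mathbb{Z}$ by $S_B[0,k]=\delta_{0,k}$ and $S_B[n,k]=S_B[n-1,k-1]+[2k+1]S_B[n-1,k]$ for $n\ge1$. Define $c_B[n,k]$ by $c_B[0,k]=\delta_{0,k}$ and $c_B[n,k]=c_B[n-1,k-1]+[2n-1]c_B[n-1,k]$ for $n\ge1$, and $s_B[n,k]=(-1)^{n-k}c_B[n,k]$. -}

module Defs where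

open import Data.Nat as ℕ using (ℕ; zero; suc)
open import Data.Integer as ℤ using (ℤ; +_; 0ℤ; 1ℤ)
open import Data.Bool using (true; false)
open import Relation.Binary.PropositionalEquality using (_≡_)

-- Formal power series in q over ℤ, represented by coefficient functions.
-- ℤ[q] embeds into this ring, so polynomial identities can be checked here.
Poly : Set
Poly = ℕ → ℤ

_≈P_ : Poly → Poly → Set
f ≈P g = ∀ d → f d ≡ g d
infix 4 _≈P_

0P : Poly
0P _ = 0ℤ

1P : Poly
1P zero    = 1ℤ
1P (suc _) = 0ℤ

_+P_ : Poly → Poly → Poly
(f +P g) d = f d ℤ.+ g d
infixl 6 _+P_

-P_ : Poly → Poly
(-P f) d = ℤ.- f d

sumTo : (ℕ → ℤ) → ℕ → ℤ
sumTo h zero    = h zero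
sumTo h (suc n) = sumTo h n ℤ.+ h (suc n)

_*P_ : Poly → Poly → Poly
(f *P g) d = sumTo (λ i → f i ℤ.* g (d ℕ.∸ i)) d
infixl 7 _*P_

-- q-integer [m] = 1 + q + ... + q^(m-1) = (1 - q^m)/(1 - q)
qint : ℕ → Poly
qint m d with d ℕ.<ᵇ m
... | true  = 1ℤ
... | false = 0ℤ

sumP : (ℕ → Poly) → ℕ → Poly
sumP P zero    = P zero
sumP P (suc n) = sumP P n +P P (suc n)

-- S_B[n,k] for n,k ≥ 0 (entries with k < 0 are 0, so S_B[n-1,-1] = 0)
SB : ℕ → ℕ → Poly
SB zero    zero    = 1P
SB zero    (suc k) = 0P
SB (suc n) zero    = qint 1 *P SB n zero
SB (suc n) (suc k) = SB n k +P qint (2 ℕ.* suc k ℕ.+ 1) *P SB n (suc k)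

cB : ℕ → ℕ → Poly
cB zero    zero    = 1P
cB zero    (suc k) = 0P
cB (suc n) zero    = qint (2 ℕ.* suc n ℕ.∸ 1) *P cB n zero
cB (suc n) (suc k) = cB n k +P qint (2 ℕ.* suc n ℕ.∸ 1) *P cB n (suc k)

signP : ℕ → Poly → Poly
signP zero    f = f
signP (suc m) f = -P (signP m f)

-- s_B[n,k] = (-1)^(n-k) c_B[n,k]  (for k > n, c_B[n,k] = 0 so the sign is irrelevant)
sB : ℕ → ℕ → Poly
sB n k = signP (n ℕ.∸ k) (cB n k)

δP : ℕ → ℕ → Poly
δP zero    zero    = 1P
δP zero    (suc k) = 0P
δP (suc n) zero    = 0P
δP (suc n) (suc k) = δP n k

{-# OPTIONS --safe #-}
-- Write T[n,k] = Σ_j s_B[n,j] S_B[j,k].  The recurrence of c_B gives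
-- s_B[n+1,j] = s_B[n,j-1] − [2n+1] s_B[n,j], and that of S_B gives
-- S_B[j+1,k] = S_B[j,k-1] + [2k+1] S_B[j,k].  Substituting both into T[n+1,k] yields
-- T[n+1,k] = T[n,k-1] + ([2k+1] − [2n+1]) T[n,k], so by induction T[n,k] = δ_{n,k}:
-- the second term vanishes because δ_{n,k} ≠ 0 forces k = n.
module Submission where

open import Defs
open import Data.Nat as ℕ using (ℕ; zero; suc; z≤n; s≤s)
import Data.Nat.Properties as ℕ
open import Data.Integer as ℤ using (ℤ; 0ℤ; 1ℤ)
import Data.Integer.Properties as ℤ
open import Data.Product using (_,_)
open import Relation.Binary.PropositionalEquality as ≡ using (_≡_; _≢_; cong; cong₂; module ≡-Reasoning)
open import Relation.Nullary using (yes; no)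
open import Data.Empty using (⊥-elim)
open import Function using (_∘_)
open import Algebra.Bundles using (CommutativeRing)
open import Algebra.Properties.CommutativeSemigroup ℤ.+-commutativeSemigroup
  using () renaming (interchange to ℤ-+-interchange)
import Algebra.Construct.Pointwise as Pointwise
import Algebra.Properties.Ring as RingProperties

sumTo-cong-≤ : ∀ {f g} n → (∀ i → i ℕ.≤ n → f i ≡ g i) → sumTo f n ≡ sumTo g n
sumTo-cong-≤ zero f≡g = f≡g 0 z≤n
sumTo-cong-≤ (suc n) f≡g =
  cong₂ ℤ._+_ (sumTo-cong-≤ n (λ i i≤n → f≡g i (ℕ.m≤n⇒m≤1+n i≤n))) (f≡g (suc n) ℕ.≤-refl)

sumTo-cong : ∀ {f g} n → (∀ i → f i ≡ g i) → sumTo f n ≡ sumTo g n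
sumTo-cong n f≡g = sumTo-cong-≤ n (λ i _ → f≡g i)

sumTo-+ : ∀ f g n → sumTo (λ i → f i ℤ.+ g i) n ≡ sumTo f n ℤ.+ sumTo g n
sumTo-+ f g zero = ≡.refl
sumTo-+ f g (suc n) rewrite sumTo-+ f g n = ℤ-+-interchange (sumTo f n) (sumTo g n) (f (suc n)) (g (suc n))

*-distribˡ-sumTo : ∀ c f n → c ℤ.* sumTo f n ≡ sumTo (λ i → c ℤ.* f i) n
*-distribˡ-sumTo c f zero = ≡.refl
*-distribˡ-sumTo c f (suc n) rewrite ≡.sym (*-distribˡ-sumTo c f n) = ℤ.*-distribˡ-+ c (sumTo f n) (f (suc n))

*-distribʳ-sumTo : ∀ c f n → sumTo f n ℤ.* c ≡ sumTo (λ i → f i ℤ.* c) n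
*-distribʳ-sumTo c f zero = ≡.refl
*-distribʳ-sumTo c f (suc n) rewrite ≡.sym (*-distribʳ-sumTo c f n) = ℤ.*-distribʳ-+ c (sumTo f n) (f (suc n))

sumTo-zero : ∀ n → sumTo (λ _ → 0ℤ) n ≡ 0ℤ
sumTo-zero zero = ≡.refl
sumTo-zero (suc n) rewrite sumTo-zero n = ≡.refl

sumTo-unconsˡ : ∀ h n → sumTo h (suc n) ≡ h 0 ℤ.+ sumTo (λ i → h (suc i)) n
sumTo-unconsˡ h zero = ≡.refl
sumTo-unconsˡ h (suc n) rewrite sumTo-unconsˡ h n = ℤ.+-assoc (h 0) _ _

sumTo-reverse : ∀ h n → sumTo h n ≡ sumTo (λ i → h (n ℕ.∸ i)) n
sumTo-reverse h zero = ≡.refl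
sumTo-reverse h (suc n) = begin
  sumTo h n ℤ.+ h (suc n)                     ≡⟨ cong (ℤ._+ h (suc n)) (sumTo-reverse h n) ⟩
  sumTo (λ i → h (n ℕ.∸ i)) n ℤ.+ h (suc n)   ≡⟨ ℤ.+-comm _ (h (suc n)) ⟩
  h (suc n) ℤ.+ sumTo (λ i → h (n ℕ.∸ i)) n   ≡⟨ ≡.sym (sumTo-unconsˡ (λ i → h (suc n ℕ.∸ i)) n) ⟩
  sumTo (λ i → h (suc n ℕ.∸ i)) (suc n)       ∎
  where open ≡-Reasoning

sumTo-triangle : ∀ (F : ℕ → ℕ → ℤ) m →
  sumTo (λ i → sumTo (F i) i) m ≡ sumTo (λ j → sumTo (λ t → F (j ℕ.+ t) j) (m ℕ.∸ j)) m
sumTo-triangle F zero = ≡.refl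
sumTo-triangle F (suc m) = begin
  sumTo (λ i → sumTo (F i) i) m ℤ.+ sumTo (F (suc m)) (suc m)
    ≡⟨ cong (ℤ._+ sumTo (F (suc m)) (suc m)) (sumTo-triangle F m) ⟩
  Columns m ℤ.+ (sumTo (F (suc m)) m ℤ.+ F (suc m) (suc m))
    ≡⟨ ≡.sym (ℤ.+-assoc (Columns m) _ _) ⟩
  (Columns m ℤ.+ sumTo (F (suc m)) m) ℤ.+ F (suc m) (suc m)
    ≡⟨ cong (ℤ._+ F (suc m) (suc m)) (≡.sym (sumTo-+ _ _ m)) ⟩
  sumTo (λ j → Column j m ℤ.+ F (suc m) j) m ℤ.+ F (suc m) (suc m)
    ≡⟨ cong₂ ℤ._+_ (sumTo-cong-≤ m extend-column) (cong (λ x → F x (suc m)) (≡.sym (ℕ.+-identityʳ (suc m)))) ⟩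
  sumTo (λ j → Column j (suc m)) m ℤ.+ F (suc m ℕ.+ 0) (suc m)
    ≡⟨ cong (λ x → sumTo (λ j → Column j (suc m)) m ℤ.+ sumTo (λ t → F (suc m ℕ.+ t) (suc m)) x) (≡.sym (ℕ.n∸n≡0 m)) ⟩
  Columns (suc m) ∎
  where
  open ≡-Reasoning
  Column : ℕ → ℕ → ℤ
  Column j m = sumTo (λ t → F (j ℕ.+ t) j) (m ℕ.∸ j)
  Columns : ℕ → ℤ
  Columns m = sumTo (λ j → Column j m) m
  extend-column : ∀ j → j ℕ.≤ m → Column j m ℤ.+ F (suc m) j ≡ Column j (suc m)
  extend-column j j≤m rewrite ℕ.+-∸-assoc 1 j≤m =
    cong (λ x → Column j m ℤ.+ F x j)
         (≡.sym (≡.trans (ℕ.+-suc j (m ℕ.∸ j)) (cong suc (ℕ.m+[n∸m]≡n j≤m))))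

*P-cong : ∀ {f f′ g g′} → f ≈P f′ → g ≈P g′ → f *P g ≈P f′ *P g′
*P-cong f≈f′ g≈g′ d = sumTo-cong d (λ i → cong₂ ℤ._*_ (f≈f′ i) (g≈g′ (d ℕ.∸ i)))

*P-comm : ∀ f g → f *P g ≈P g *P f
*P-comm f g d = ≡.trans (sumTo-reverse _ d) (sumTo-cong-≤ d λ i i≤d →
  ≡.trans (cong (λ x → f (d ℕ.∸ i) ℤ.* g x) (ℕ.m∸[m∸n]≡n i≤d)) (ℤ.*-comm (f (d ℕ.∸ i)) (g i)))

*P-assoc : ∀ f g h → (f *P g) *P h ≈P f *P (g *P h)
*P-assoc f g h d = begin
  sumTo (λ i → sumTo (λ j → f j ℤ.* g (i ℕ.∸ j)) i ℤ.* h (d ℕ.∸ i)) d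
    ≡⟨ sumTo-cong d (λ i → *-distribʳ-sumTo _ _ i) ⟩
  sumTo (λ i → sumTo (λ j → f j ℤ.* g (i ℕ.∸ j) ℤ.* h (d ℕ.∸ i)) i) d
    ≡⟨ sumTo-triangle (λ i j → f j ℤ.* g (i ℕ.∸ j) ℤ.* h (d ℕ.∸ i)) d ⟩
  sumTo (λ j → sumTo (λ t → f j ℤ.* g (j ℕ.+ t ℕ.∸ j) ℤ.* h (d ℕ.∸ (j ℕ.+ t))) (d ℕ.∸ j)) d
    ≡⟨ sumTo-cong d (λ j → sumTo-cong (d ℕ.∸ j) (λ t →
         ≡.trans (cong₂ (λ a b → f j ℤ.* g a ℤ.* h b) (ℕ.m+n∸m≡n j t) (≡.sym (ℕ.∸-+-assoc d j t)))
                 (ℤ.*-assoc (f j) _ _))) ⟩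
  sumTo (λ j → sumTo (λ t → f j ℤ.* (g t ℤ.* h (d ℕ.∸ j ℕ.∸ t))) (d ℕ.∸ j)) d
    ≡⟨ sumTo-cong d (λ j → ≡.sym (*-distribˡ-sumTo (f j) _ (d ℕ.∸ j))) ⟩
  sumTo (λ j → f j ℤ.* sumTo (λ t → g t ℤ.* h (d ℕ.∸ j ℕ.∸ t)) (d ℕ.∸ j)) d ∎
  where open ≡-Reasoning

*P-distribˡ : ∀ f g h → f *P (g +P h) ≈P f *P g +P f *P h
*P-distribˡ f g h d = ≡.trans (sumTo-cong d (λ i → ℤ.*-distribˡ-+ (f i) _ _)) (sumTo-+ _ _ d)

*P-distribʳ : ∀ f g h → (g +P h) *P f ≈P g *P f +P h *P f
*P-distribʳ f g h d = ≡.trans (sumTo-cong d (λ i → ℤ.*-distribʳ-+ (f (d ℕ.∸ i)) (g i) (h i))) (sumTo-+ _ _ d)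

*P-identityˡ : ∀ f → 1P *P f ≈P f
*P-identityˡ f zero = ℤ.*-identityˡ (f 0)
*P-identityˡ f (suc d) = begin
  sumTo (λ i → 1P i ℤ.* f (suc d ℕ.∸ i)) (suc d) ≡⟨ sumTo-unconsˡ (λ i → 1P i ℤ.* f (suc d ℕ.∸ i)) d ⟩
  1ℤ ℤ.* f (suc d) ℤ.+ sumTo (λ _ → 0ℤ) d        ≡⟨ cong₂ ℤ._+_ (ℤ.*-identityˡ (f (suc d))) (sumTo-zero d) ⟩
  f (suc d) ℤ.+ 0ℤ                                ≡⟨ ℤ.+-identityʳ (f (suc d)) ⟩
  f (suc d)                                       ∎
  where open ≡-Reasoning

*P-identityʳ : ∀ f → f *P 1P ≈P f
*P-identityʳ f d = ≡.trans (*P-comm f 1P d) (*P-identityˡ f d)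

Poly-commutativeRing : CommutativeRing _ _
Poly-commutativeRing = record
  { Carrier = Poly ; _≈_ = _≈P_ ; _+_ = _+P_ ; _*_ = _*P_ ; -_ = -P_ ; 0# = 0P ; 1# = 1P
  ; isCommutativeRing = record
    { isRing = record
      { +-isAbelianGroup = Pointwise.isAbelianGroup ℕ ℤ.+-0-isAbelianGroup
      ; *-cong           = *P-cong
      ; *-assoc          = *P-assoc
      ; *-identity       = *P-identityˡ , *P-identityʳ
      ; distrib          = *P-distribˡ , *P-distribʳ
      }
    ; *-comm = *P-comm
    }
  }

open CommutativeRing Poly-commutativeRing
open RingProperties ring using (-0#≈0#; -‿+-comm; -‿distribˡ-*; -‿distribʳ-*)
open import Algebra.Properties.CommutativeSemigroup +-commutativeSemigroup
  using () renaming (interchange to +-interchange)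
open import Algebra.Properties.CommutativeSemigroup *-commutativeSemigroup
  using () renaming (x∙yz≈y∙xz to x*[y*z]≈y*[x*z])
open import Relation.Binary.Reasoning.Setoid setoid

sumP-cong : ∀ {P Q} n → (∀ j → P j ≈ Q j) → sumP P n ≈ sumP Q n
sumP-cong zero P≈Q = P≈Q 0
sumP-cong (suc n) P≈Q = +-cong (sumP-cong n P≈Q) (P≈Q (suc n))

sumP-zero : ∀ {P} n → (∀ j → P j ≈ 0#) → sumP P n ≈ 0#
sumP-zero zero P≈0 = P≈0 0
sumP-zero (suc n) P≈0 = trans (+-cong (sumP-zero n P≈0) (P≈0 (suc n))) (+-identityˡ 0#)

sumP-unconsˡ : ∀ P n → sumP P (suc n) ≈ P 0 + sumP (λ j → P (suc j)) n
sumP-unconsˡ P zero = refl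
sumP-unconsˡ P (suc n) = trans (+-congʳ {P (suc (suc n))} (sumP-unconsˡ P n)) (+-assoc (P 0) _ (P (suc (suc n))))

sumP-dropˡ : ∀ {P} n → P 0 ≈ 0# → sumP P (suc n) ≈ sumP (λ j → P (suc j)) n
sumP-dropˡ {P} n P0≈0 = trans (sumP-unconsˡ P n) (trans (+-congʳ {sumP (λ j → P (suc j)) n} P0≈0) (+-identityˡ _))

sumP-dropʳ : ∀ {P} n → P (suc n) ≈ 0# → sumP P (suc n) ≈ sumP P n
sumP-dropʳ {P} n Pn≈0 = trans (+-congˡ {sumP P n} Pn≈0) (+-identityʳ _)

sumP-linear : ∀ P c Q n → sumP (λ j → P j + c * Q j) n ≈ sumP P n + c * sumP Q n
sumP-linear P c Q zero = refl
sumP-linear P c Q (suc n) = begin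
  sumP (λ j → P j + c * Q j) n + (P (suc n) + c * Q (suc n))
    ≈⟨ +-congʳ {P (suc n) + c * Q (suc n)} (sumP-linear P c Q n) ⟩
  (sumP P n + c * sumP Q n) + (P (suc n) + c * Q (suc n))
    ≈⟨ +-interchange (sumP P n) _ _ _ ⟩
  sumP P (suc n) + (c * sumP Q n + c * Q (suc n))
    ≈⟨ +-congˡ {sumP P (suc n)} (sym (distribˡ c (sumP Q n) (Q (suc n)))) ⟩
  sumP P (suc n) + c * sumP Q (suc n) ∎

qodd : ℕ → Poly
qodd n = qint (2 ℕ.* n ℕ.+ 1)

qint-2[1+n]∸1 : ∀ n → qint (2 ℕ.* suc n ℕ.∸ 1) ≈ qodd n
qint-2[1+n]∸1 n d = cong (λ m → qint m d) (≡.sym 2n+1≡2[1+n]∸1)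
  where
  2n+1≡2[1+n]∸1 : 2 ℕ.* n ℕ.+ 1 ≡ 2 ℕ.* suc n ℕ.∸ 1
  2n+1≡2[1+n]∸1 = ≡.trans (ℕ.+-assoc n (n ℕ.+ 0) 1) (cong (n ℕ.+_) (ℕ.+-comm (n ℕ.+ 0) 1))

shift : (ℕ → Poly) → ℕ → Poly
shift f zero    = 0#
shift f (suc k) = f k

shift-cong : ∀ {f g} → (∀ k → f k ≈ g k) → ∀ k → shift f k ≈ shift g k
shift-cong f≈g zero    = refl
shift-cong f≈g (suc k) = f≈g k

signP-cong : ∀ m {f g} → f ≈ g → signP m f ≈ signP m g
signP-cong zero    f≈g = f≈g
signP-cong (suc m) f≈g = -‿cong (signP-cong m f≈g)

signP-0# : ∀ m → signP m 0# ≈ 0#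
signP-0# zero    = refl
signP-0# (suc m) = trans (-‿cong (signP-0# m)) -0#≈0#

signP-+ : ∀ m f g → signP m (f + g) ≈ signP m f + signP m g
signP-+ zero    f g = refl
signP-+ (suc m) f g = trans (-‿cong (signP-+ m f g)) (sym (-‿+-comm (signP m f) (signP m g)))

signP-*ˡ : ∀ m a f → signP m (a * f) ≈ a * signP m f
signP-*ˡ zero    a f = refl
signP-*ˡ (suc m) a f = trans (-‿cong (signP-*ˡ m a f)) (-‿distribʳ-* a (signP m f))

x≈0⇒x≈-x : ∀ {x} → x ≈ 0# → x ≈ - x
x≈0⇒x≈-x x≈0 = trans x≈0 (trans (sym -0#≈0#) (-‿cong (sym x≈0)))

-- When m ≤ j the exponents m ∸ j and m ∸ suc j are both 0, so the sign flip needs f ≈ 0.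
signP-∸-suc : ∀ m j f → (m ℕ.≤ j → f ≈ 0#) → signP (m ℕ.∸ j) f ≈ - signP (m ℕ.∸ suc j) f
signP-∸-suc zero    zero    f f≈0 = x≈0⇒x≈-x (f≈0 z≤n)
signP-∸-suc zero    (suc j) f f≈0 = x≈0⇒x≈-x (f≈0 z≤n)
signP-∸-suc (suc m) zero    f f≈0 = refl
signP-∸-suc (suc m) (suc j) f f≈0 = signP-∸-suc m j f (λ m≤j → f≈0 (s≤s m≤j))

cB-vanish : ∀ {n j} → n ℕ.< j → cB n j ≈ 0#
cB-vanish {zero}  {suc j} _         = refl
cB-vanish {suc n} {suc j} (s≤s n<j) = begin
  cB n j + A * cB n (suc j)
    ≈⟨ +-cong (cB-vanish n<j) (*-congˡ {A} (cB-vanish (ℕ.m<n⇒m<1+n n<j))) ⟩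
  0# + A * 0#
    ≈⟨ +-identityˡ (A * 0#) ⟩
  A * 0#
    ≈⟨ zeroʳ A ⟩
  0# ∎
  where A = qint (2 ℕ.* suc n ℕ.∸ 1)

sB-vanish : ∀ {n j} → n ℕ.< j → sB n j ≈ 0#
sB-vanish {n} {j} n<j = trans (signP-cong (n ℕ.∸ j) (cB-vanish n<j)) (signP-0# (n ℕ.∸ j))

sB-suc : ∀ n j → sB (suc n) j ≈ shift (sB n) j + - qodd n * sB n j
sB-suc n zero = begin
  - signP n (A * cB n 0)  ≈⟨ -‿cong (signP-*ˡ n A (cB n 0)) ⟩
  - (A * sB n 0)          ≈⟨ -‿distribˡ-* A (sB n 0) ⟩
  - A * sB n 0            ≈⟨ *-congʳ {sB n 0} (-‿cong (qint-2[1+n]∸1 n)) ⟩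
  - qodd n * sB n 0       ≈⟨ sym (+-identityˡ _) ⟩
  0# + - qodd n * sB n 0  ∎
  where A = qint (2 ℕ.* suc n ℕ.∸ 1)
sB-suc n (suc j) = begin
  signP (n ℕ.∸ j) (cB n j + A * cB n (suc j))  ≈⟨ signP-+ (n ℕ.∸ j) (cB n j) (A * cB n (suc j)) ⟩
  sB n j + signP (n ℕ.∸ j) (A * cB n (suc j))  ≈⟨ +-congˡ {sB n j} (signP-*ˡ (n ℕ.∸ j) A (cB n (suc j))) ⟩
  sB n j + A * signP (n ℕ.∸ j) (cB n (suc j))  ≈⟨ +-congˡ {sB n j} (*-congˡ {A} sign-flip) ⟩
  sB n j + A * - sB n (suc j)                  ≈⟨ +-congˡ {sB n j} (sym (-‿distribʳ-* A (sB n (suc j)))) ⟩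
  sB n j + - (A * sB n (suc j))                ≈⟨ +-congˡ {sB n j} (-‿distribˡ-* A (sB n (suc j))) ⟩
  sB n j + - A * sB n (suc j)                  ≈⟨ +-congˡ {sB n j} (*-congʳ {sB n (suc j)} (-‿cong (qint-2[1+n]∸1 n))) ⟩
  sB n j + - qodd n * sB n (suc j)             ∎
  where
  A = qint (2 ℕ.* suc n ℕ.∸ 1)
  sign-flip : signP (n ℕ.∸ j) (cB n (suc j)) ≈ - sB n (suc j)
  sign-flip = signP-∸-suc n j (cB n (suc j)) (λ n≤j → cB-vanish (s≤s n≤j))

SB-suc : ∀ j k → SB (suc j) k ≈ shift (SB j) k + qodd k * SB j k
SB-suc j zero    = sym (+-identityˡ _)
SB-suc j (suc k) = refl

[x+cy]z≈xz+c[yz] : ∀ x c y z → (x + c * y) * z ≈ x * z + c * (y * z)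
[x+cy]z≈xz+c[yz] x c y z = trans (distribʳ z x (c * y)) (+-congˡ {x * z} (*-assoc c y z))

x[y+cz]≈xy+c[xz] : ∀ x y c z → x * (y + c * z) ≈ x * y + c * (x * z)
x[y+cz]≈xy+c[xz] x y c z = trans (distribˡ x y (c * z)) (+-congˡ {x * y} (x*[y*z]≈y*[x*z] x c z))

sumP-*-shift : ∀ (P : ℕ → Poly) (Q : ℕ → ℕ → Poly) n k →
  sumP (λ j → P j * shift (Q j) k) n ≈ shift (λ k → sumP (λ j → P j * Q j k) n) k
sumP-*-shift P Q n zero    = sumP-zero n (λ j → zeroʳ (P j))
sumP-*-shift P Q n (suc k) = refl

sB*SB : ℕ → ℕ → Poly
sB*SB n k = sumP (λ j → sB n j * SB j k) n

sB*SB⁺ : ℕ → ℕ → Poly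
sB*SB⁺ n k = sumP (λ j → sB n j * SB (suc j) k) n

sB*SB-suc≈sB*SB⁺ : ∀ n k → sB*SB (suc n) k ≈ sB*SB⁺ n k + - qodd n * sB*SB n k
sB*SB-suc≈sB*SB⁺ n k = begin
  sumP (λ j → sB (suc n) j * SB j k) (suc n)
    ≈⟨ sumP-cong (suc n) (λ j → trans (*-congʳ {SB j k} (sB-suc n j))
                                       ([x+cy]z≈xz+c[yz] (shift (sB n) j) (- qodd n) (sB n j) (SB j k))) ⟩
  sumP (λ j → shift (sB n) j * SB j k + - qodd n * (sB n j * SB j k)) (suc n)
    ≈⟨ sumP-linear (λ j → shift (sB n) j * SB j k) (- qodd n) (λ j → sB n j * SB j k) (suc n) ⟩
  sumP (λ j → shift (sB n) j * SB j k) (suc n) + - qodd n * sumP (λ j → sB n j * SB j k) (suc n)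
    ≈⟨ +-cong (sumP-dropˡ n (zeroˡ (SB 0 k))) (*-congˡ { - qodd n} (sumP-dropʳ n last-term≈0)) ⟩
  sB*SB⁺ n k + - qodd n * sB*SB n k ∎
  where
  last-term≈0 : sB n (suc n) * SB (suc n) k ≈ 0#
  last-term≈0 = trans (*-congʳ {SB (suc n) k} (sB-vanish (ℕ.n<1+n n))) (zeroˡ (SB (suc n) k))

sB*SB⁺-expand : ∀ n k → sB*SB⁺ n k ≈ shift (sB*SB n) k + qodd k * sB*SB n k
sB*SB⁺-expand n k = begin
  sumP (λ j → sB n j * SB (suc j) k) n
    ≈⟨ sumP-cong n (λ j → trans (*-congˡ {sB n j} (SB-suc j k))
                                (x[y+cz]≈xy+c[xz] (sB n j) (shift (SB j) k) (qodd k) (SB j k))) ⟩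
  sumP (λ j → sB n j * shift (SB j) k + qodd k * (sB n j * SB j k)) n
    ≈⟨ sumP-linear (λ j → sB n j * shift (SB j) k) (qodd k) (λ j → sB n j * SB j k) n ⟩
  sumP (λ j → sB n j * shift (SB j) k) n + qodd k * sB*SB n k
    ≈⟨ +-congʳ {qodd k * sB*SB n k} (sumP-*-shift (sB n) SB n k) ⟩
  shift (sB*SB n) k + qodd k * sB*SB n k ∎

sB*SB-suc : ∀ n k → sB*SB (suc n) k ≈ shift (sB*SB n) k + (qodd k - qodd n) * sB*SB n k
sB*SB-suc n k = begin
  sB*SB (suc n) k                           ≈⟨ sB*SB-suc≈sB*SB⁺ n k ⟩
  sB*SB⁺ n k + - qodd n * T                 ≈⟨ +-congʳ { - qodd n * T} (sB*SB⁺-expand n k) ⟩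
  shift (sB*SB n) k + qodd k * T + - qodd n * T   ≈⟨ +-assoc (shift (sB*SB n) k) _ _ ⟩
  shift (sB*SB n) k + (qodd k * T + - qodd n * T) ≈⟨ +-congˡ {shift (sB*SB n) k} (sym (distribʳ T (qodd k) (- qodd n))) ⟩
  shift (sB*SB n) k + (qodd k - qodd n) * T       ∎
  where T = sB*SB n k

δP-off-diagonal : ∀ {n k} → n ≢ k → δP n k ≈ 0#
δP-off-diagonal {zero}  {zero}  n≢k = ⊥-elim (n≢k ≡.refl)
δP-off-diagonal {zero}  {suc k} n≢k = refl
δP-off-diagonal {suc n} {zero}  n≢k = refl
δP-off-diagonal {suc n} {suc k} n≢k = δP-off-diagonal (n≢k ∘ cong suc)

[fk-fn]δPnk≈0 : ∀ (f : ℕ → Poly) n k → (f k - f n) * δP n k ≈ 0#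
[fk-fn]δPnk≈0 f n k with n ℕ.≟ k
... | yes ≡.refl = trans (*-congʳ {δP n n} (-‿inverseʳ (f n))) (zeroˡ (δP n n))
... | no n≢k     = trans (*-congˡ {f k - f n} (δP-off-diagonal n≢k)) (zeroʳ (f k - f n))

shift-δP : ∀ n k → shift (δP n) k ≈ δP (suc n) k
shift-δP n zero    = refl
shift-δP n (suc k) = refl

SB-zero : ∀ k → SB 0 k ≈ δP 0 k
SB-zero zero    = refl
SB-zero (suc k) = refl

corollary2p7 : ∀ (n k : ℕ) → sumP (λ j → sB n j *P SB j k) n ≈P δP n k
corollary2p7 zero    k = trans (*-identityˡ (SB 0 k)) (SB-zero k)
corollary2p7 (suc n) k = begin
  sB*SB (suc n) k                                    ≈⟨ sB*SB-suc n k ⟩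
  shift (sB*SB n) k + (qodd k - qodd n) * sB*SB n k  ≈⟨ +-cong (shift-cong (corollary2p7 n) k)
                                                               (*-congˡ {qodd k - qodd n} (corollary2p7 n k)) ⟩
  shift (δP n) k + (qodd k - qodd n) * δP n k        ≈⟨ +-cong (shift-δP n k) ([fk-fn]δPnk≈0 qodd n k) ⟩
  δP (suc n) k + 0#                                  ≈⟨ +-identityʳ (δP (suc n) k) ⟩
  δP (suc n) k                                       ∎
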